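{- Let $q$ be an odd prime power with $q\ge5$, let $n\ge2$ with $q\equiv1\pmod n$, and let $a\in\mathbb{F}_q^*$ be such that $-a$ has multiplicative order $n$. Let $b\in\mathbb{F}_q^*$ be arbitrary and $\mathbf{O}_n=\{x_1,\ldots,x_n\}$ with $x_i=b\sum_{j=0}^{n-i}(-1/a)^{j+1}$ for $1\le i\le n$. Let $F:\mathbb{F}_q\to\mathbb{F}_q$ be defined by $F(\delta)=(a+1)\delta+b$ for $\delta\notin\mathbf{O}_n$, $F(x_i)=ax_{i-1}+x_i+b$ for $2\le i\le n$, and $F(x_1)=0$. Then $|V_F|=q-n$; moreover exactly $n$ elements of $\mathbb{F}_q$ have no preimage under $F$, exactly $q-n-1$ elements have exactly one preimage, exactly one element has exactly $n+1$ preimages, and no element has any other number of preimages.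
   Context: $V_F=\{F(c):c\in\mathbb{F}_q\}$ denotes the value set of $F$. (Here $x_1=0$ and $x_n=-b/a$, and $F=f+x$ where $f$ is the permutation with $f=g$ off $\mathbf{O}_n$, $f(x_i)=g(x_{i-1})$ for $i\ge2$, $f(x_1)=g(x_n)=0$, $g(x)=ax+b$.) -}

module Defs where

open import Level using (0ℓ)
open import Data.Nat as ℕ using (ℕ; zero; suc)
open import Data.Fin using (Fin; toℕ)
open import Data.List using (List; map; filter; length)
open import Data.List.Base using (allFin)
import Data.Maybe
open import Data.Product using (Σ; _×_; _,_)
open import Relation.Nullary using (¬_; Dec; yes; no)
open import Relation.Binary.PropositionalEquality using (_≡_)
open import Function.Bundles using (_↔_; Inverse)
import Algebra.Structures as AS

record FiniteField (q : ℕ) : Set₁ where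
  infixl 6 _+_
  infixl 7 _*_
  field
    Carrier : Set
    _+_ _*_ : Carrier → Carrier → Carrier
    -_ : Carrier → Carrier
    0# 1# : Carrier
    isCommutativeRing : AS.IsCommutativeRing {A = Carrier} _≡_ _+_ _*_ -_ 0# 1#
    _⁻¹ : Carrier → Carrier
    ⁻¹-inverse : ∀ x → ¬ x ≡ 0# → x * (x ⁻¹) ≡ 1#
    0≢1 : ¬ 0# ≡ 1#
    _≟_ : (x y : Carrier) → Dec (x ≡ y)
    enumeration : Fin q ↔ Carrier

  _^_ : Carrier → ℕ → Carrier
  x ^ zero = 1#
  x ^ suc k = x * (x ^ k)

  elements : List Carrier
  elements = map (Inverse.to enumeration) (allFin q)

  HasOrder : Carrier → ℕ → Set
  HasOrder x n = (1 ℕ.≤ n) × (x ^ n ≡ 1#) × (∀ k → 1 ℕ.≤ k → k ℕ.< n → ¬ x ^ k ≡ 1#)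

  geomSum : Carrier → ℕ → Carrier
  geomSum t zero = t
  geomSum t (suc m) = geomSum t m + t ^ (suc (suc m))

  xOrb : (a b : Carrier) (n i : ℕ) → Carrier
  xOrb a b n i = b * geomSum (- (a ⁻¹)) (n ℕ.∸ i)

  -- firstIndex returns the least i with 1 ≤ i ≤ n and δ ≡ x_i, if any.
  firstIndexFrom : (a b : Carrier) (n : ℕ) (δ : Carrier) (i fuel : ℕ) → Data.Maybe.Maybe ℕ
  firstIndexFrom a b n δ i zero = Data.Maybe.nothing
  firstIndexFrom a b n δ i (suc fuel) with δ ≟ xOrb a b n i
  ... | yes _ = Data.Maybe.just i
  ... | no _ = firstIndexFrom a b n δ (suc i) fuel

  firstIndex : (a b : Carrier) (n : ℕ) (δ : Carrier) → Data.Maybe.Maybe ℕ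
  firstIndex a b n δ = firstIndexFrom a b n δ 1 n

  F : (a b : Carrier) (n : ℕ) → Carrier → Carrier
  F a b n δ with firstIndex a b n δ
  ... | Data.Maybe.nothing = (a + 1#) * δ + b
  ... | Data.Maybe.just zero = 0#              -- does not occur
  ... | Data.Maybe.just (suc zero) = 0#
  ... | Data.Maybe.just (suc (suc k)) = a * xOrb a b n (suc k) + xOrb a b n (suc (suc k)) + b

  preimageCount : (Carrier → Carrier) → Carrier → ℕ
  preimageCount G y = length (filter (λ c → G c ≟ y) elements)

  numWithPreimages : (Carrier → Carrier) → ℕ → ℕ
  numWithPreimages G m = length (filter (λ y → preimageCount G y ℕ.≟ m) elements)

  valueSetSize : (Carrier → Carrier) → ℕ
  valueSetSize G = length (filter (λ y → 1 ℕ.≤? preimageCount G y) elements)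

-- Write t = -1/a and G m = t + t² + ⋯ + t^(m+1), so that x_i = b·G(n-i). From a·t = -1 one gets
-- (a+1)·G m + 1 = t^(m+1) and a·G(m+1) + G m + 1 = 0. The second identity says F(x_i) = 0 for
-- i ≥ 2, so the whole orbit lies in the fibre of 0. Off the orbit F is the affine bijection
-- L c = (a+1)c + b (a ≠ -1 because -a has order n ≥ 2), and the first identity shows
-- L(x_i) = b·t^(n-i+1) ≠ 0. Hence 0 has the n + 1 preimages x_1, …, x_n, L⁻¹ 0; the n values
-- L(x_i) have none; every other value y has exactly the preimage L⁻¹ y. Since the powers
-- t, …, tⁿ are distinct, so are the x_i, which makes all these counts exact.

module Submission where

open import Defs
open import Level using (Level)
open import Data.Nat as ℕ using (ℕ; zero; suc; _∸_; _≤_; _<_; _%_; z≤n; s≤s)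
import Data.Nat.Properties as ℕ
open import Data.Nat.Divisibility using (_∣_)
open import Data.Nat.Primality using (Prime)
open import Data.Fin using (Fin; toℕ; fromℕ<)
open import Data.Fin.Properties using (toℕ-injective; toℕ<n; toℕ-fromℕ<)
open import Data.Maybe using (just; nothing)
open import Data.Empty using (⊥-elim)
open import Data.Product using (Σ; _×_; _,_; proj₁; proj₂)
open import Data.Sum using (_⊎_; inj₁; inj₂)
open import Data.List using (List; []; _∷_; [_]; map; filter; length)
open import Data.List.Base using (allFin)
open import Data.List.Properties using (length-map; length-tabulate)
open import Data.List.Relation.Unary.Any using (here; there)
import Data.List.Relation.Unary.All as All
open import Data.List.Relation.Unary.AllPairs using ([]; _∷_)
open import Data.List.Relation.Unary.Unique.Propositional using (Unique)
import Data.List.Relation.Unary.Unique.Propositional.Properties as Unique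
open import Data.List.Membership.Propositional using (_∈_; _∉_)
open import Data.List.Membership.Propositional.Properties
  using (∈-filter⁺; ∈-filter⁻; ∈-map⁺; ∈-map⁻; ∈-allFin)
open import Data.List.Membership.Propositional.Properties.WithK using (unique∧set⇒bag)
open import Data.List.Relation.Binary.BagAndSetEquality using (∼bag⇒↭)
open import Data.List.Relation.Binary.Permutation.Propositional.Properties using (↭-length)
open import Data.List.Relation.Binary.Subset.Propositional using (_⊆_)
open import Function.Base using (_∘_)
open import Function.Bundles using (Inverse; Equivalence; _⇔_; mk⇔)
open import Relation.Nullary using (¬_; yes; no)
open import Relation.Unary using (Pred; Decidable)
open import Relation.Unary.Properties using (∁?)
open import Relation.Binary.PropositionalEquality using (_≡_; refl; sym; trans; cong; subst; module ≡-Reasoning)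
open import Relation.Binary.Definitions using (tri<; tri≈; tri>)
open import Algebra.Bundles using (CommutativeRing)

private
  variable
    ℓ : Level
    A : Set

length-filter-∁ : {P : Pred A ℓ} (P? : Decidable P) (xs : List A) →
  length (filter P? xs) ℕ.+ length (filter (∁? P?) xs) ≡ length xs
length-filter-∁ P? [] = refl
length-filter-∁ P? (x ∷ xs) with P? x
... | yes _ = cong suc (length-filter-∁ P? xs)
... | no _ = trans (ℕ.+-suc _ _) (cong suc (length-filter-∁ P? xs))

length-filter-unique : {P : Pred A ℓ} (P? : Decidable P) {xs ys : List A} →
  Unique xs → Unique ys → ys ⊆ xs → (∀ {x} → P x ⇔ x ∈ ys) →
  length (filter P? xs) ≡ length ys
length-filter-unique P? {xs} {ys} uxs uys ys⊆xs P⇔ys =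
  ↭-length (∼bag⇒↭ (unique∧set⇒bag (Unique.filter⁺ P? uxs) uys (mk⇔ to from)))
  where
  to : ∀ {x} → x ∈ filter P? xs → x ∈ ys
  to x∈ = Equivalence.to P⇔ys (proj₂ (∈-filter⁻ P? {xs = xs} x∈))
  from : ∀ {x} → x ∈ ys → x ∈ filter P? xs
  from x∈ = ∈-filter⁺ P? (ys⊆xs x∈) (Equivalence.from P⇔ys x∈)

module FiniteFieldTheory {q : ℕ} (𝔽 : FiniteField q) where
  open FiniteField 𝔽
  open import Data.List.Membership.DecPropositional _≟_ using (_∈?_)

  commutativeRing : CommutativeRing _ _
  commutativeRing = record { isCommutativeRing = isCommutativeRing }

  open CommutativeRing commutativeRing
    using (+-assoc; +-identityˡ; +-identityʳ; -‿inverseˡ; -‿inverseʳ;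
           *-assoc; *-comm; *-identityˡ; *-identityʳ; zeroˡ; zeroʳ;
           ring; commutativeSemiring; *-commutativeSemigroup)
  open import Algebra.Properties.Ring ring using (-‿distribʳ-*; -‿distribˡ-*; -‿involutive; +-inverseʳ-unique)
  open import Algebra.Properties.CommutativeSemigroup *-commutativeSemigroup using (interchange)
  open import Algebra.Solver.Ring.NaturalCoefficients commutativeSemiring (λ _ _ → nothing)
    using (solve; _:=_; _:+_; _:*_; con)
  open ≡-Reasoning

  elements-unique : Unique elements
  elements-unique = Unique.map⁺ to-injective (Unique.allFin⁺ q)
    where
    to-injective : ∀ {i j} → Inverse.to enumeration i ≡ Inverse.to enumeration j → i ≡ j
    to-injective {i} {j} eq = begin
      i                                                   ≡⟨ Inverse.strictlyInverseʳ enumeration i ⟨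
      Inverse.from enumeration (Inverse.to enumeration i) ≡⟨ cong (Inverse.from enumeration) eq ⟩
      Inverse.from enumeration (Inverse.to enumeration j) ≡⟨ Inverse.strictlyInverseʳ enumeration j ⟩
      j                                                   ∎

  ∈-elements : ∀ x → x ∈ elements
  ∈-elements x = subst (_∈ elements) (Inverse.strictlyInverseˡ enumeration x)
    (∈-map⁺ (Inverse.to enumeration) (∈-allFin (Inverse.from enumeration x)))

  length-elements : length elements ≡ q
  length-elements = trans (length-map _ (allFin q)) (length-tabulate _)

  count : {P : Pred Carrier ℓ} → Decidable P → ℕ
  count P? = length (filter P? elements)

  count≡length : {P : Pred Carrier ℓ} (P? : Decidable P) {ys : List Carrier} →
    Unique ys → (∀ {x} → P x ⇔ x ∈ ys) → count P? ≡ length ys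
  count≡length P? uys = length-filter-unique P? elements-unique uys (λ {x} _ → ∈-elements x)

  count-complement : {P : Pred Carrier ℓ} (P? : Decidable P) → count P? ≡ q ∸ count (∁? P?)
  count-complement P? = begin
    count P?                                     ≡⟨ ℕ.m+n∸n≡m (count P?) (count (∁? P?)) ⟨
    count P? ℕ.+ count (∁? P?) ∸ count (∁? P?)   ≡⟨ cong (_∸ count (∁? P?)) (trans (length-filter-∁ P? elements) length-elements) ⟩
    q ∸ count (∁? P?)                            ∎

  *-solveˡ : ∀ {x y z} → ¬ x ≡ 0# → x * y ≡ z → y ≡ x ⁻¹ * z
  *-solveˡ {x} {y} {z} x≢0 eq = begin
    y                ≡⟨ *-identityˡ y ⟨
    1# * y           ≡⟨ cong (_* y) (trans (*-comm (x ⁻¹) x) (⁻¹-inverse x x≢0)) ⟨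
    x ⁻¹ * x * y     ≡⟨ *-assoc (x ⁻¹) x y ⟩
    x ⁻¹ * (x * y)   ≡⟨ cong (x ⁻¹ *_) eq ⟩
    x ⁻¹ * z         ∎

  *-cancelˡ : ∀ {x y z} → ¬ x ≡ 0# → x * y ≡ x * z → y ≡ z
  *-cancelˡ x≢0 eq = trans (*-solveˡ x≢0 eq) (sym (*-solveˡ x≢0 refl))

  *-nonzero : ∀ {x y} → ¬ x ≡ 0# → ¬ y ≡ 0# → ¬ x * y ≡ 0#
  *-nonzero x≢0 y≢0 xy≡0 = y≢0 (*-cancelˡ x≢0 (trans xy≡0 (sym (zeroʳ _))))

  +-solveʳ : ∀ {x b y} → x + b ≡ y → x ≡ y + - b
  +-solveʳ {x} {b} {y} eq = begin
    x                ≡⟨ +-identityʳ x ⟨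
    x + 0#           ≡⟨ cong (x +_) (-‿inverseʳ b) ⟨
    x + (b + - b)    ≡⟨ +-assoc x b (- b) ⟨
    x + b + - b      ≡⟨ cong (_+ - b) eq ⟩
    y + - b          ∎

  affine-solve : ∀ {s b c y} → ¬ s ≡ 0# → s * c + b ≡ y ⇔ c ≡ s ⁻¹ * (y + - b)
  affine-solve {s} {b} {c} {y} s≢0 = mk⇔ (*-solveˡ s≢0 ∘ +-solveʳ) λ { refl → begin
    s * (s ⁻¹ * (y + - b)) + b    ≡⟨ cong (_+ b) (*-assoc s (s ⁻¹) _) ⟨
    s * s ⁻¹ * (y + - b) + b      ≡⟨ cong (λ u → u * (y + - b) + b) (⁻¹-inverse s s≢0) ⟩
    1# * (y + - b) + b            ≡⟨ cong (_+ b) (*-identityˡ _) ⟩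
    y + - b + b                   ≡⟨ +-assoc y (- b) b ⟩
    y + (- b + b)                 ≡⟨ cong (y +_) (-‿inverseˡ b) ⟩
    y + 0#                        ≡⟨ +-identityʳ y ⟩
    y                             ∎ }

  ^-+ : ∀ x i j → x ^ (i ℕ.+ j) ≡ x ^ i * x ^ j
  ^-+ x zero j = sym (*-identityˡ _)
  ^-+ x (suc i) j = trans (cong (x *_) (^-+ x i j)) (sym (*-assoc x _ _))

  ^-distrib-* : ∀ x y k → (x * y) ^ k ≡ x ^ k * y ^ k
  ^-distrib-* x y zero = sym (*-identityˡ 1#)
  ^-distrib-* x y (suc k) = trans (cong ((x * y) *_) (^-distrib-* x y k)) (interchange x y _ _)

  1^ : ∀ k → 1# ^ k ≡ 1#
  1^ zero = refl
  1^ (suc k) = trans (*-identityˡ _) (1^ k)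

  ^-nonzero : ∀ {x} k → ¬ x ≡ 0# → ¬ x ^ k ≡ 0#
  ^-nonzero zero x≢0 = 0≢1 ∘ sym
  ^-nonzero (suc k) x≢0 = *-nonzero x≢0 (^-nonzero k x≢0)

  ^-one-inverse : ∀ {x y} k → x * y ≡ 1# → x ^ k ≡ 1# → y ^ k ≡ 1#
  ^-one-inverse {x} {y} k xy≡1 xᵏ≡1 = begin
    y ^ k              ≡⟨ *-identityˡ (y ^ k) ⟨
    1# * y ^ k         ≡⟨ cong (_* y ^ k) xᵏ≡1 ⟨
    x ^ k * y ^ k      ≡⟨ ^-distrib-* x y k ⟨
    (x * y) ^ k        ≡⟨ cong (_^ k) xy≡1 ⟩
    1# ^ k             ≡⟨ 1^ k ⟩
    1#                 ∎

  HasOrder-inverse : ∀ {x y n} → x * y ≡ 1# → HasOrder x n → HasOrder y n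
  HasOrder-inverse {x} {y} {n} xy≡1 (1≤n , xⁿ≡1 , minimal) =
    1≤n , ^-one-inverse n xy≡1 xⁿ≡1 ,
    λ k 1≤k k<n yᵏ≡1 → minimal k 1≤k k<n (^-one-inverse k (trans (*-comm y x) xy≡1) yᵏ≡1)

  HasOrder⇒nonzero : ∀ {x n} → HasOrder x n → ¬ x ≡ 0#
  HasOrder⇒nonzero {n = suc _} (_ , xⁿ≡1 , _) refl = 0≢1 (trans (sym (zeroˡ _)) xⁿ≡1)

  ^-distinct : ∀ {x n i j} → HasOrder x n → i < j → j < n → ¬ x ^ i ≡ x ^ j
  ^-distinct {x} {i = i} {j} order@(_ , _ , minimal) i<j j<n xⁱ≡xʲ =
    minimal (j ∸ i) (ℕ.m<n⇒0<n∸m i<j) (ℕ.≤-<-trans (ℕ.m∸n≤m j i) j<n)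
      (sym (*-cancelˡ (^-nonzero i (HasOrder⇒nonzero order)) (begin
        x ^ i * 1#              ≡⟨ *-identityʳ _ ⟩
        x ^ i                   ≡⟨ xⁱ≡xʲ ⟩
        x ^ j                   ≡⟨ cong (x ^_) (ℕ.m+[n∸m]≡n (ℕ.<⇒≤ i<j)) ⟨
        x ^ (i ℕ.+ (j ∸ i))     ≡⟨ ^-+ x i (j ∸ i) ⟩
        x ^ i * x ^ (j ∸ i)     ∎)))

  ^-injective : ∀ {x n i j} → HasOrder x n → i < n → j < n → x ^ i ≡ x ^ j → i ≡ j
  ^-injective {i = i} {j} order i<n j<n xⁱ≡xʲ with ℕ.<-cmp i j
  ... | tri< i<j _ _ = ⊥-elim (^-distinct order i<j j<n xⁱ≡xʲ)
  ... | tri≈ _ i≡j _ = i≡j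
  ... | tri> _ _ j<i = ⊥-elim (^-distinct order j<i i<n (sym xⁱ≡xʲ))

  module GeometricSum {a t : Carrier} (a*t+1≡0 : a * t + 1# ≡ 0#) where

    private
      [a+1]*t+1≡t : (a + 1#) * t + 1# ≡ t
      [a+1]*t+1≡t = begin
        (a + 1#) * t + 1#     ≡⟨ solve 2 (λ a t → (a :+ con 1) :* t :+ con 1 := (a :* t :+ con 1) :+ t) refl a t ⟩
        (a * t + 1#) + t      ≡⟨ cong (_+ t) a*t+1≡0 ⟩
        0# + t                ≡⟨ +-identityˡ t ⟩
        t                     ∎

    geomSum-closed : ∀ m → (a + 1#) * geomSum t m + 1# ≡ t ^ suc m
    geomSum-closed zero = trans [a+1]*t+1≡t (sym (*-identityʳ t))
    geomSum-closed (suc m) = let G = geomSum t m; T = t ^ suc m in begin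
      (a + 1#) * (G + t * T) + 1#       ≡⟨ solve 4 (λ a t G T → (a :+ con 1) :* (G :+ t :* T) :+ con 1
                                                 := ((a :+ con 1) :* G :+ con 1) :+ ((a :+ con 1) :* t) :* T) refl a t G T ⟩
      ((a + 1#) * G + 1#) + ((a + 1#) * t) * T ≡⟨ cong (_+ ((a + 1#) * t) * T) (geomSum-closed m) ⟩
      T + ((a + 1#) * t) * T            ≡⟨ solve 2 (λ u T → T :+ u :* T := (u :+ con 1) :* T) refl ((a + 1#) * t) T ⟩
      ((a + 1#) * t + 1#) * T           ≡⟨ cong (_* T) [a+1]*t+1≡t ⟩
      t * T                             ∎

    geomSum-recurrence : ∀ m → a * geomSum t (suc m) + geomSum t m + 1# ≡ 0#
    geomSum-recurrence m = let G = geomSum t m; T = t ^ suc m in begin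
      a * (G + t * T) + G + 1#          ≡⟨ solve 4 (λ a t G T → a :* (G :+ t :* T) :+ G :+ con 1
                                                 := ((a :+ con 1) :* G :+ con 1) :+ (a :* t) :* T) refl a t G T ⟩
      ((a + 1#) * G + 1#) + (a * t) * T ≡⟨ cong (_+ (a * t) * T) (geomSum-closed m) ⟩
      T + (a * t) * T                   ≡⟨ solve 2 (λ u T → T :+ u :* T := (u :+ con 1) :* T) refl (a * t) T ⟩
      (a * t + 1#) * T                  ≡⟨ cong (_* T) a*t+1≡0 ⟩
      0# * T                            ≡⟨ zeroˡ T ⟩
      0#                                ∎

    geomSum-injective : ∀ {n i j} → HasOrder t n → i < n → j < n → geomSum t i ≡ geomSum t j → i ≡ j
    geomSum-injective {i = i} {j} order i<n j<n Gᵢ≡Gⱼ =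
      ^-injective order i<n j<n (*-cancelˡ (HasOrder⇒nonzero order) (begin
        t ^ suc i                          ≡⟨ geomSum-closed i ⟨
        (a + 1#) * geomSum t i + 1#        ≡⟨ cong (λ G → (a + 1#) * G + 1#) Gᵢ≡Gⱼ ⟩
        (a + 1#) * geomSum t j + 1#        ≡⟨ geomSum-closed j ⟩
        t ^ suc j                          ∎))

  module PreimagesOfF {n : ℕ} (n≥2 : 2 ≤ n) {a : Carrier} (a≢0 : ¬ a ≡ 0#)
                      (-a-order : HasOrder (- a) n) {b : Carrier} (b≢0 : ¬ b ≡ 0#) where

    t : Carrier
    t = - (a ⁻¹)

    a*t≡-1 : a * t ≡ - 1#
    a*t≡-1 = trans (sym (-‿distribʳ-* a (a ⁻¹))) (cong -_ (⁻¹-inverse a a≢0))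

    -a*t≡1 : - a * t ≡ 1#
    -a*t≡1 = begin
      - a * t       ≡⟨ -‿distribˡ-* a t ⟨
      - (a * t)     ≡⟨ cong -_ a*t≡-1 ⟩
      - - 1#        ≡⟨ -‿involutive 1# ⟩
      1#            ∎

    t-order : HasOrder t n
    t-order = HasOrder-inverse -a*t≡1 -a-order

    a+1≢0 : ¬ a + 1# ≡ 0#
    a+1≢0 a+1≡0 = proj₂ (proj₂ -a-order) 1 ℕ.≤-refl n≥2
      (trans (*-identityʳ (- a)) (sym (+-inverseʳ-unique a 1# a+1≡0)))

    open GeometricSum (trans (cong (_+ 1#) a*t≡-1) (-‿inverseˡ 1#))

    G : ℕ → Carrier
    G = geomSum t

    -- x i is the paper's x_{i+1}, so that orbit lists x_1, ..., x_n.
    x : Fin n → Carrier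
    x i = xOrb a b n (suc (toℕ i))

    orbit : List Carrier
    orbit = map x (allFin n)

    n∸suc<n : ∀ {i} → i < n → n ∸ suc i < n
    n∸suc<n i<n = ℕ.∸-monoʳ-< (s≤s z≤n) i<n

    x-injective : ∀ {i j} → x i ≡ x j → i ≡ j
    x-injective {i} {j} xᵢ≡xⱼ = toℕ-injective (ℕ.suc-injective (ℕ.∸-cancelˡ-≡ (toℕ<n i) (toℕ<n j)
      (geomSum-injective t-order (n∸suc<n (toℕ<n i)) (n∸suc<n (toℕ<n j)) (*-cancelˡ b≢0 xᵢ≡xⱼ))))

    orbit-unique : Unique orbit
    orbit-unique = Unique.map⁺ x-injective (Unique.allFin⁺ n)

    length-orbit : length orbit ≡ n
    length-orbit = trans (length-map x (allFin n)) (length-tabulate _)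

    orbit-recurrence : ∀ m → a * (b * G (suc m)) + b * G m + b ≡ 0#
    orbit-recurrence m = begin
      a * (b * G (suc m)) + b * G m + b       ≡⟨ solve 4 (λ a b G₁ G₀ → a :* (b :* G₁) :+ b :* G₀ :+ b
                                                      := b :* (a :* G₁ :+ G₀ :+ con 1)) refl a b (G (suc m)) (G m) ⟩
      b * (a * G (suc m) + G m + 1#)          ≡⟨ cong (b *_) (geomSum-recurrence m) ⟩
      b * 0#                                  ≡⟨ zeroʳ b ⟩
      0#                                      ∎

    L : Carrier → Carrier
    L c = (a + 1#) * c + b

    L⁻¹ : Carrier → Carrier
    L⁻¹ y = (a + 1#) ⁻¹ * (y + - b)

    L-solve : ∀ {c y} → L c ≡ y ⇔ c ≡ L⁻¹ y
    L-solve = affine-solve a+1≢0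

    L-L⁻¹ : ∀ y → L (L⁻¹ y) ≡ y
    L-L⁻¹ y = Equivalence.from L-solve refl

    L-injective : ∀ {c d} → L c ≡ L d → c ≡ d
    L-injective {c} {d} eq = trans (Equivalence.to L-solve eq) (sym (Equivalence.to L-solve refl))

    L-geomSum : ∀ m → L (b * G m) ≡ b * t ^ suc m
    L-geomSum m = begin
      (a + 1#) * (b * G m) + b       ≡⟨ solve 3 (λ a b G → (a :+ con 1) :* (b :* G) :+ b
                                             := b :* ((a :+ con 1) :* G :+ con 1)) refl a b (G m) ⟩
      b * ((a + 1#) * G m + 1#)      ≡⟨ cong (b *_) (geomSum-closed m) ⟩
      b * t ^ suc m                  ∎

    L-orbit-nonzero : ∀ {c} → c ∈ orbit → ¬ L c ≡ 0#
    L-orbit-nonzero c∈ with ∈-map⁻ x c∈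
    ... | i , _ , refl = *-nonzero b≢0 (^-nonzero (suc m) (HasOrder⇒nonzero t-order)) ∘ trans (sym (L-geomSum m))
      where m = n ∸ suc (toℕ i)

    firstIndexFrom-just : ∀ {δ} i fuel {j} → firstIndexFrom a b n δ i fuel ≡ just j →
      i ≤ j × j < i ℕ.+ fuel × δ ≡ xOrb a b n j
    firstIndexFrom-just {δ} i (suc fuel) {j} eq with δ ≟ xOrb a b n i
    firstIndexFrom-just i (suc fuel) refl | yes δ≡xᵢ = ℕ.≤-refl , ℕ.m<m+n i (s≤s z≤n) , δ≡xᵢ
    ... | no _ with firstIndexFrom-just (suc i) fuel eq
    ...   | i<j , j<i+1+fuel , δ≡xⱼ = ℕ.<⇒≤ i<j , subst (j <_) (sym (ℕ.+-suc i fuel)) j<i+1+fuel , δ≡xⱼ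

    firstIndexFrom-nothing : ∀ {δ} i fuel {j} → firstIndexFrom a b n δ i fuel ≡ nothing →
      i ≤ j → j < i ℕ.+ fuel → ¬ δ ≡ xOrb a b n j
    firstIndexFrom-nothing i zero _ i≤j j<i+0 =
      ⊥-elim (ℕ.<-irrefl refl (ℕ.≤-<-trans i≤j (subst (_ <_) (ℕ.+-identityʳ i) j<i+0)))
    firstIndexFrom-nothing {δ} i (suc fuel) {j} eq i≤j j<i+1+fuel with δ ≟ xOrb a b n i
    firstIndexFrom-nothing i (suc fuel) () i≤j j<i+1+fuel | yes _
    ... | no δ≢xᵢ with i ℕ.≟ j
    ...   | yes refl = δ≢xᵢ
    ...   | no i≢j = firstIndexFrom-nothing (suc i) fuel eq (ℕ.≤∧≢⇒< i≤j i≢j)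
                         (subst (j <_) (ℕ.+-suc i fuel) j<i+1+fuel)

    firstIndex-just⇒∈orbit : ∀ {c j} → firstIndex a b n c ≡ just j → c ∈ orbit
    firstIndex-just⇒∈orbit eq with firstIndexFrom-just 1 n eq
    ... | s≤s z≤n , s≤s j<n , c≡xⱼ =
      subst (_∈ orbit) (trans (cong (λ k → xOrb a b n (suc k)) (toℕ-fromℕ< j<n)) (sym c≡xⱼ))
        (∈-map⁺ x (∈-allFin (fromℕ< j<n)))

    ∈orbit⇒firstIndex≢nothing : ∀ {c} → c ∈ orbit → ¬ firstIndex a b n c ≡ nothing
    ∈orbit⇒firstIndex≢nothing c∈ eq with ∈-map⁻ x c∈
    ... | i , _ , c≡xᵢ = firstIndexFrom-nothing 1 n eq (s≤s z≤n) (s≤s (toℕ<n i)) c≡xᵢ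

    Fₙ : Carrier → Carrier
    Fₙ = F a b n

    F-orbit : ∀ {c} → c ∈ orbit → Fₙ c ≡ 0#
    F-orbit {c} c∈ with firstIndex a b n c in eq
    ... | nothing = ⊥-elim (∈orbit⇒firstIndex≢nothing c∈ eq)
    ... | just zero = ⊥-elim (ℕ.1+n≰n (proj₁ (firstIndexFrom-just 1 n eq)))
    ... | just (suc zero) = refl
    ... | just (suc (suc k)) =
      trans (cong (λ m → a * (b * G m) + xOrb a b n (suc (suc k)) + b) (ℕ.+-∸-assoc 1 k+2≤n))
            (orbit-recurrence (n ∸ suc (suc k)))
      where
      k+2≤n : suc (suc k) ≤ n
      k+2≤n = ℕ.≤-pred (proj₁ (proj₂ (firstIndexFrom-just 1 n eq)))

    F-off : ∀ {c} → c ∉ orbit → Fₙ c ≡ L c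
    F-off {c} c∉ with firstIndex a b n c in eq
    ... | nothing = refl
    ... | just j = ⊥-elim (c∉ (firstIndex-just⇒∈orbit eq))

    L⁻¹0∉orbit : L⁻¹ 0# ∉ orbit
    L⁻¹0∉orbit c∈ = L-orbit-nonzero c∈ (L-L⁻¹ 0#)

    holes : List Carrier
    holes = map L orbit

    L⁻¹∉orbit : ∀ {y} → y ∉ holes → L⁻¹ y ∉ orbit
    L⁻¹∉orbit y∉ c∈ = y∉ (subst (_∈ holes) (L-L⁻¹ _) (∈-map⁺ L c∈))

    0∉holes : 0# ∉ holes
    0∉holes y∈ with ∈-map⁻ L y∈
    ... | c , c∈ , 0≡Lc = L-orbit-nonzero c∈ (sym 0≡Lc)

    F≡0⇔ : ∀ {c} → Fₙ c ≡ 0# ⇔ c ∈ L⁻¹ 0# ∷ orbit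
    F≡0⇔ {c} = mk⇔ to λ { (here refl) → trans (F-off L⁻¹0∉orbit) (L-L⁻¹ 0#) ; (there c∈) → F-orbit c∈ }
      where
      to : Fₙ c ≡ 0# → c ∈ L⁻¹ 0# ∷ orbit
      to Fc≡0 with c ∈? orbit
      ... | yes c∈ = there c∈
      ... | no c∉ = here (Equivalence.to L-solve (trans (sym (F-off c∉)) Fc≡0))

    F≢hole : ∀ {c y} → y ∈ holes → ¬ Fₙ c ≡ y
    F≢hole {c} y∈ Fc≡y with ∈-map⁻ L y∈ | c ∈? orbit
    ... | s , s∈ , refl | yes c∈ = L-orbit-nonzero s∈ (trans (sym Fc≡y) (F-orbit c∈))
    ... | s , s∈ , refl | no c∉ = c∉ (subst (_∈ orbit) (sym (L-injective (trans (sym (F-off c∉)) Fc≡y))) s∈)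

    F≡y⇔ : ∀ {c y} → ¬ y ≡ 0# → y ∉ holes → Fₙ c ≡ y ⇔ c ∈ [ L⁻¹ y ]
    F≡y⇔ {c} {y} y≢0 y∉ = mk⇔ to λ { (here refl) → trans (F-off (L⁻¹∉orbit y∉)) (L-L⁻¹ y) }
      where
      to : Fₙ c ≡ y → c ∈ [ L⁻¹ y ]
      to Fc≡y with c ∈? orbit
      ... | yes c∈ = ⊥-elim (y≢0 (trans (sym Fc≡y) (F-orbit c∈)))
      ... | no c∉ = here (Equivalence.to L-solve (trans (sym (F-off c∉)) Fc≡y))

    preimageCount-0 : preimageCount Fₙ 0# ≡ n ℕ.+ 1
    preimageCount-0 = begin
      preimageCount Fₙ 0#         ≡⟨ count≡length _ (All.tabulate (λ { c∈ refl → L⁻¹0∉orbit c∈ }) ∷ orbit-unique) F≡0⇔ ⟩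
      suc (length orbit)          ≡⟨ cong suc length-orbit ⟩
      suc n                       ≡⟨ ℕ.+-comm 1 n ⟩
      n ℕ.+ 1                     ∎

    preimageCount-hole : ∀ {y} → y ∈ holes → preimageCount Fₙ y ≡ 0
    preimageCount-hole y∈ = count≡length _ [] (mk⇔ (⊥-elim ∘ F≢hole y∈) λ ())

    preimageCount-other : ∀ {y} → ¬ y ≡ 0# → y ∉ holes → preimageCount Fₙ y ≡ 1
    preimageCount-other y≢0 y∉ = count≡length _ (All.[] ∷ []) (F≡y⇔ y≢0 y∉)

    preimageCount-cases : ∀ y → (y ≡ 0# × preimageCount Fₙ y ≡ n ℕ.+ 1)
                              ⊎ (y ∈ holes × preimageCount Fₙ y ≡ 0)
                              ⊎ (y ∉ holes × preimageCount Fₙ y ≡ 1)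
    preimageCount-cases y with y ≟ 0# | y ∈? holes
    ... | yes y≡0 | _ = inj₁ (y≡0 , subst (λ y → preimageCount Fₙ y ≡ n ℕ.+ 1) (sym y≡0) preimageCount-0)
    ... | no _ | yes y∈ = inj₂ (inj₁ (y∈ , preimageCount-hole y∈))
    ... | no y≢0 | no y∉ = inj₂ (inj₂ (y∉ , preimageCount-other y≢0 y∉))

    n+1≢0 : ¬ n ℕ.+ 1 ≡ 0
    n+1≢0 = ℕ.m+1+n≢0 n

    n+1≢1 : ¬ n ℕ.+ 1 ≡ 1
    n+1≢1 n+1≡1 with () ← subst (2 ≤_) (ℕ.+-cancelʳ-≡ 1 n 0 n+1≡1) n≥2

    preimageCount-values : ∀ y → let m = preimageCount Fₙ y in m ≡ 0 ⊎ m ≡ 1 ⊎ m ≡ n ℕ.+ 1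
    preimageCount-values y with preimageCount-cases y
    ... | inj₁ (_ , m≡n+1) = inj₂ (inj₂ m≡n+1)
    ... | inj₂ (inj₁ (_ , m≡0)) = inj₁ m≡0
    ... | inj₂ (inj₂ (_ , m≡1)) = inj₂ (inj₁ m≡1)

    holes-unique : Unique holes
    holes-unique = Unique.map⁺ L-injective orbit-unique

    length-holes : length holes ≡ n
    length-holes = trans (length-map L orbit) length-orbit

    numWithPreimages-0 : numWithPreimages Fₙ 0 ≡ n
    numWithPreimages-0 = trans (count≡length _ holes-unique (mk⇔ to preimageCount-hole)) length-holes
      where
      to : ∀ {y} → preimageCount Fₙ y ≡ 0 → y ∈ holes
      to {y} m≡0 with preimageCount-cases y
      ... | inj₁ (_ , m≡n+1) = ⊥-elim (n+1≢0 (trans (sym m≡n+1) m≡0))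
      ... | inj₂ (inj₁ (y∈ , _)) = y∈
      ... | inj₂ (inj₂ (_ , m≡1)) = ⊥-elim (ℕ.1+n≢0 (trans (sym m≡1) m≡0))

    numWithPreimages-n+1 : numWithPreimages Fₙ (n ℕ.+ 1) ≡ 1
    numWithPreimages-n+1 = count≡length _ (All.[] ∷ []) (mk⇔ to λ { (here refl) → preimageCount-0 })
      where
      to : ∀ {y} → preimageCount Fₙ y ≡ n ℕ.+ 1 → y ∈ [ 0# ]
      to {y} m≡n+1 with preimageCount-cases y
      ... | inj₁ (y≡0 , _) = here y≡0
      ... | inj₂ (inj₁ (_ , m≡0)) = ⊥-elim (n+1≢0 (trans (sym m≡n+1) m≡0))
      ... | inj₂ (inj₂ (_ , m≡1)) = ⊥-elim (n+1≢1 (trans (sym m≡n+1) m≡1))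

    numWithPreimages-1 : numWithPreimages Fₙ 1 ≡ q ∸ n ∸ 1
    numWithPreimages-1 = begin
      numWithPreimages Fₙ 1      ≡⟨ count-complement _ ⟩
      q ∸ count (∁? P?)          ≡⟨ cong (q ∸_) (count≡length _ unique (mk⇔ to from)) ⟩
      q ∸ suc (length holes)     ≡⟨ cong (λ k → q ∸ suc k) length-holes ⟩
      q ∸ suc n                  ≡⟨ cong (q ∸_) (ℕ.+-comm 1 n) ⟩
      q ∸ (n ℕ.+ 1)              ≡⟨ ℕ.∸-+-assoc q n 1 ⟨
      q ∸ n ∸ 1                  ∎
      where
      P? : Decidable (λ y → preimageCount Fₙ y ≡ 1)
      P? y = preimageCount Fₙ y ℕ.≟ 1
      unique : Unique (0# ∷ holes)
      unique = All.tabulate (λ { y∈ refl → 0∉holes y∈ }) ∷ holes-unique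
      to : ∀ {y} → ¬ preimageCount Fₙ y ≡ 1 → y ∈ 0# ∷ holes
      to {y} m≢1 with preimageCount-cases y
      ... | inj₁ (y≡0 , _) = here y≡0
      ... | inj₂ (inj₁ (y∈ , _)) = there y∈
      ... | inj₂ (inj₂ (_ , m≡1)) = ⊥-elim (m≢1 m≡1)
      from : ∀ {y} → y ∈ 0# ∷ holes → ¬ preimageCount Fₙ y ≡ 1
      from (here refl) = n+1≢1 ∘ trans (sym preimageCount-0)
      from (there y∈) = ℕ.0≢1+n ∘ trans (sym (preimageCount-hole y∈))

    valueSetSize-F : valueSetSize Fₙ ≡ q ∸ n
    valueSetSize-F = begin
      valueSetSize Fₙ            ≡⟨ count-complement _ ⟩
      q ∸ count (∁? P?)          ≡⟨ cong (q ∸_) (count≡length _ holes-unique (mk⇔ to from)) ⟩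
      q ∸ length holes           ≡⟨ cong (q ∸_) length-holes ⟩
      q ∸ n                      ∎
      where
      P? : Decidable (λ y → 1 ≤ preimageCount Fₙ y)
      P? y = 1 ℕ.≤? preimageCount Fₙ y
      to : ∀ {y} → ¬ 1 ≤ preimageCount Fₙ y → y ∈ holes
      to {y} m≱1 with preimageCount-cases y
      ... | inj₁ (_ , m≡n+1) = ⊥-elim (m≱1 (subst (1 ≤_) (sym m≡n+1) (ℕ.m≤n+m 1 n)))
      ... | inj₂ (inj₁ (y∈ , _)) = y∈
      ... | inj₂ (inj₂ (_ , m≡1)) = ⊥-elim (m≱1 (subst (1 ≤_) (sym m≡1) ℕ.≤-refl))
      from : ∀ {y} → y ∈ holes → ¬ 1 ≤ preimageCount Fₙ y
      from y∈ = ℕ.1+n≰n ∘ subst (1 ≤_) (preimageCount-hole y∈)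

theorem9 : (q : ℕ) → (𝔽 : FiniteField q) →
    (Σ ℕ λ p → Σ ℕ λ k → Prime p × q ≡ p ℕ.^ k) → q % 2 ≡ 1 → 5 ≤ q →
    (n : ℕ) → 2 ≤ n → n ∣ q ∸ 1 →
    (a : FiniteField.Carrier 𝔽) → ¬ a ≡ FiniteField.0# 𝔽 →
    FiniteField.HasOrder 𝔽 (FiniteField.-_ 𝔽 a) n →
    (b : FiniteField.Carrier 𝔽) → ¬ b ≡ FiniteField.0# 𝔽 →
    (FiniteField.valueSetSize 𝔽 (FiniteField.F 𝔽 a b n) ≡ q ∸ n)
    × (FiniteField.numWithPreimages 𝔽 (FiniteField.F 𝔽 a b n) 0 ≡ n)
    × (FiniteField.numWithPreimages 𝔽 (FiniteField.F 𝔽 a b n) 1 ≡ q ∸ n ∸ 1)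
    × (FiniteField.numWithPreimages 𝔽 (FiniteField.F 𝔽 a b n) (n ℕ.+ 1) ≡ 1)
    × (∀ y → let m = FiniteField.preimageCount 𝔽 (FiniteField.F 𝔽 a b n) y in
    m ≡ 0 ⊎ m ≡ 1 ⊎ m ≡ n ℕ.+ 1)
theorem9 q 𝔽 _ _ _ n n≥2 _ a a≢0 -a-order b b≢0 =
  valueSetSize-F , numWithPreimages-0 , numWithPreimages-1 , numWithPreimages-n+1 , preimageCount-values
  where open FiniteFieldTheory 𝔽 using (module PreimagesOfF)
        open PreimagesOfF n≥2 a≢0 -a-order b≢0
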